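{- Let $\mathcal{E}$ be a set of eNDT extension axioms and $A,B$ eNDT formulas with $A\succeq_\mathcal{E} B$. Then there are $\mathsf{eLNDT}$ proofs of $B\to A$ over $\mathcal{E}$ of size polynomial (in the sizes of $A$, $B$ and $\mathcal{E}$). If moreover $\mathcal{E},A,B$ are $\lor$-free, these proofs are $\mathsf{eLDT}$ proofs.
   Context: Propositional variables $p,q,\dots$ and disjoint extension variables $e_0,e_1,\dots$. eNDT formulas: $A::=0\mid1\mid ApB\mid A\lor B\mid e_i$ ($ApB$ means "if $p$ then $B$ else $A$"; $p$ is identified with $0p1$); eDT formulas ($\lor$-free) omit $\lor$. A set of extension axioms $\mathcal{E}=\{e_i\leftrightarrow E_i\}_{i<n}$ has each $E_i$ mentioning only $e_0,\dots,e_{i-1}$. $\mathsf{LNDT}$ rules: identity $A\to A$; cut; exchange, weakening, contraction on both sides; axiom $0\to$; from $\Gamma\to\Delta$ infer $\Gamma,1\to\Delta$ and $\Gamma\to\Delta,0$; axiom $\to1$; $\lor$-left (from $\Gamma,A\to\Delta$ and $\Gamma,B\to\Delta$ infer $\Gamma,A\lor B\to\Delta$); $\lor$-right (from $\Gamma\to\Delta,A,B$ infer $\Gamma\to\Delta,A\lor B$); $p$-left (from $\Gamma,A\to\Delta,p$ and $\Gamma,p,B\to\Delta$ infer $\Gamma,ApB\to\Delta$); $p$-right (from $\Gamma\to\Delta,A,p$ and $\Gamma,p\to\Delta,B$ infer $\Gamma\to\Delta,ApB$). $\mathsf{LDT}$ omits the $\lor$ rules. An $\mathsf{eLNDT}$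 ($\mathsf{eLDT}$) proof over $\mathcal{E}$ is a finite list of sequents, each a hypothesis $e_i\to E_i$ or $E_i\to e_i$ or derived from earlier ones by an $\mathsf{LNDT}$ ($\mathsf{LDT}$) rule. Simulation: $A\succeq_\mathcal{E}B$ is the smallest relation such that: $A\succeq_\mathcal{E}A$; if $A\succeq_\mathcal{E}C$ and $A\succeq_\mathcal{E}D$ then $A\succeq_\mathcal{E}C\lor D$; if $A\succeq_\mathcal{E}E_i$ then $A\succeq_\mathcal{E}e_i$; if $A\succeq_\mathcal{E}C$ and $B\succeq_\mathcal{E}D$ then $ApB\succeq_\mathcal{E}CpD$; if $A_j\succeq_\mathcal{E}B$ for some $j\in\{0,1\}$ then $A_0\lor A_1\succeq_\mathcal{E}B$; if $E_i\succeq_\mathcal{E}B$ then $e_i\succeq_\mathcal{E}B$. -}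

module Defs where

open import Data.Nat using (ℕ; zero; suc; _+_; _*_; _^_; _<_)
open import Data.List using (List; []; _∷_; _++_)
open import Data.List.Membership.Propositional using (_∈_)
open import Data.Product using (_×_; _,_)

-- eNDT formulas.  Propositional variables and extension variables are
-- both indexed by ℕ (they are disjoint since they use distinct
-- constructors).  `dt A p B` is  A p B  ("if p then B else A").

infixr 5 _∨_

data Fm : Set where
  𝟘 𝟙 : Fm
  dt  : Fm → ℕ → Fm → Fm
  _∨_ : Fm → Fm → Fm
  ext : ℕ → Fm

atom : ℕ → Fm
atom p = dt 𝟘 p 𝟙

size : Fm → ℕ
size 𝟘         = 1
size 𝟙         = 1
size (dt A p B) = suc (size A + size B)
size (A ∨ B)   = suc (size A + size B)
size (ext i)   = 1

data OrFree : Fm → Set where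
  of𝟘   : OrFree 𝟘
  of𝟙   : OrFree 𝟙
  ofdt  : ∀ {A p B} → OrFree A → OrFree B → OrFree (dt A p B)
  ofext : ∀ {i} → OrFree (ext i)

data ExtBelow (k : ℕ) : Fm → Set where
  eb𝟘   : ExtBelow k 𝟘
  eb𝟙   : ExtBelow k 𝟙
  ebdt  : ∀ {A p B} → ExtBelow k A → ExtBelow k B → ExtBelow k (dt A p B)
  eb∨   : ∀ {A B} → ExtBelow k A → ExtBelow k B → ExtBelow k (A ∨ B)
  ebext : ∀ {i} → i < k → ExtBelow k (ext i)

-- Extension axioms  ℰ = {e_i ↔ E_i}_{i<n}  are represented by the list
-- E_0, …, E_{n-1}.

ExtAx : Set
ExtAx = List Fm

data At : ExtAx → ℕ → Fm → Set where
  here  : ∀ {E ℰ} → At (E ∷ ℰ) zero E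
  there : ∀ {E F ℰ i} → At ℰ i E → At (F ∷ ℰ) (suc i) E

WellFormed : ExtAx → Set
WellFormed ℰ = ∀ {i E} → At ℰ i E → ExtBelow i E

sizeExt : ExtAx → ℕ
sizeExt []      = 0
sizeExt (E ∷ ℰ) = suc (size E + sizeExt ℰ)

AllOrFree : ExtAx → Set
AllOrFree []      = Data.Unit.⊤ where import Data.Unit
AllOrFree (E ∷ ℰ) = OrFree E × AllOrFree ℰ

data _⪰⟨_⟩_ : Fm → ExtAx → Fm → Set where
  sim-refl  : ∀ {ℰ A} → A ⪰⟨ ℰ ⟩ A
  sim-∨r    : ∀ {ℰ A C D} → A ⪰⟨ ℰ ⟩ C → A ⪰⟨ ℰ ⟩ D → A ⪰⟨ ℰ ⟩ (C ∨ D)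
  sim-extr  : ∀ {ℰ A i E} → At ℰ i E → A ⪰⟨ ℰ ⟩ E → A ⪰⟨ ℰ ⟩ ext i
  sim-dt    : ∀ {ℰ A B C D p} → A ⪰⟨ ℰ ⟩ C → B ⪰⟨ ℰ ⟩ D → dt A p B ⪰⟨ ℰ ⟩ dt C p D
  sim-∨l₀   : ∀ {ℰ A₀ A₁ B} → A₀ ⪰⟨ ℰ ⟩ B → (A₀ ∨ A₁) ⪰⟨ ℰ ⟩ B
  sim-∨l₁   : ∀ {ℰ A₀ A₁ B} → A₁ ⪰⟨ ℰ ⟩ B → (A₀ ∨ A₁) ⪰⟨ ℰ ⟩ B
  sim-extl  : ∀ {ℰ B i E} → At ℰ i E → E ⪰⟨ ℰ ⟩ B → ext i ⪰⟨ ℰ ⟩ B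

-- Sequents and (line-based) proofs.  Cedents are lists; the principal
-- formula "Γ, A" is written A ∷ Γ; exchange swaps adjacent formulas.

infix 4 _⇒_
record Seq : Set where
  constructor _⇒_
  field
    ante succ : List Fm

data System : Set where
  LNDT LDT : System

data Step : System → ExtAx → List Seq → Seq → Set where
  hyp-l   : ∀ {sys ℰ L i E} → At ℰ i E → Step sys ℰ L ((ext i ∷ []) ⇒ (E ∷ []))
  hyp-r   : ∀ {sys ℰ L i E} → At ℰ i E → Step sys ℰ L ((E ∷ []) ⇒ (ext i ∷ []))
  ident   : ∀ {sys ℰ L A} → Step sys ℰ L ((A ∷ []) ⇒ (A ∷ []))
  cut     : ∀ {sys ℰ L Γ Δ A} → (Γ ⇒ (A ∷ Δ)) ∈ L → ((A ∷ Γ) ⇒ Δ) ∈ L → Step sys ℰ L (Γ ⇒ Δ)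
  exch-l  : ∀ {sys ℰ L Γ₁ Γ₂ A B Δ} → ((Γ₁ ++ A ∷ B ∷ Γ₂) ⇒ Δ) ∈ L
            → Step sys ℰ L ((Γ₁ ++ B ∷ A ∷ Γ₂) ⇒ Δ)
  exch-r  : ∀ {sys ℰ L Γ Δ₁ Δ₂ A B} → (Γ ⇒ (Δ₁ ++ A ∷ B ∷ Δ₂)) ∈ L
            → Step sys ℰ L (Γ ⇒ (Δ₁ ++ B ∷ A ∷ Δ₂))
  weak-l  : ∀ {sys ℰ L Γ Δ A} → (Γ ⇒ Δ) ∈ L → Step sys ℰ L ((A ∷ Γ) ⇒ Δ)
  weak-r  : ∀ {sys ℰ L Γ Δ A} → (Γ ⇒ Δ) ∈ L → Step sys ℰ L (Γ ⇒ (A ∷ Δ))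
  contr-l : ∀ {sys ℰ L Γ Δ A} → ((A ∷ A ∷ Γ) ⇒ Δ) ∈ L → Step sys ℰ L ((A ∷ Γ) ⇒ Δ)
  contr-r : ∀ {sys ℰ L Γ Δ A} → (Γ ⇒ (A ∷ A ∷ Δ)) ∈ L → Step sys ℰ L (Γ ⇒ (A ∷ Δ))
  zero-l  : ∀ {sys ℰ L} → Step sys ℰ L ((𝟘 ∷ []) ⇒ [])
  one-l   : ∀ {sys ℰ L Γ Δ} → (Γ ⇒ Δ) ∈ L → Step sys ℰ L ((𝟙 ∷ Γ) ⇒ Δ)
  zero-r  : ∀ {sys ℰ L Γ Δ} → (Γ ⇒ Δ) ∈ L → Step sys ℰ L (Γ ⇒ (𝟘 ∷ Δ))
  one-r   : ∀ {sys ℰ L} → Step sys ℰ L ([] ⇒ (𝟙 ∷ []))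
  or-l    : ∀ {ℰ L Γ Δ A B} → ((A ∷ Γ) ⇒ Δ) ∈ L → ((B ∷ Γ) ⇒ Δ) ∈ L
            → Step LNDT ℰ L (((A ∨ B) ∷ Γ) ⇒ Δ)
  or-r    : ∀ {ℰ L Γ Δ A B} → (Γ ⇒ (A ∷ B ∷ Δ)) ∈ L
            → Step LNDT ℰ L (Γ ⇒ ((A ∨ B) ∷ Δ))
  dt-l    : ∀ {sys ℰ L Γ Δ A B p} → ((A ∷ Γ) ⇒ (atom p ∷ Δ)) ∈ L
            → ((B ∷ atom p ∷ Γ) ⇒ Δ) ∈ L
            → Step sys ℰ L ((dt A p B ∷ Γ) ⇒ Δ)
  dt-r    : ∀ {sys ℰ L Γ Δ A B p} → (Γ ⇒ (atom p ∷ A ∷ Δ)) ∈ L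
            → ((atom p ∷ Γ) ⇒ (B ∷ Δ)) ∈ L
            → Step sys ℰ L (Γ ⇒ (dt A p B ∷ Δ))

-- A list of lines, stored newest-first, each justified by earlier lines.
data Lines (sys : System) (ℰ : ExtAx) : List Seq → Set where
  []  : Lines sys ℰ []
  _∷_ : ∀ {S L} → Step sys ℰ L S → Lines sys ℰ L → Lines sys ℰ (S ∷ L)

IsProofOf : System → ExtAx → Seq → List Seq → Set
IsProofOf sys ℰ S L = Lines sys ℰ (S ∷ L)

sizeCedent : List Fm → ℕ
sizeCedent []      = 0
sizeCedent (A ∷ Γ) = size A + sizeCedent Γ

sizeSeq : Seq → ℕ
sizeSeq (Γ ⇒ Δ) = suc (sizeCedent Γ + sizeCedent Δ)

sizeLines : List Seq → ℕ
sizeLines []      = 0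
sizeLines (S ∷ L) = sizeSeq S + sizeLines L

data CedentOrFree : List Fm → Set where
  []  : CedentOrFree []
  _∷_ : ∀ {A Γ} → OrFree A → CedentOrFree Γ → CedentOrFree (A ∷ Γ)

data LinesOrFree : List Seq → Set where
  []  : LinesOrFree []
  _∷_ : ∀ {Γ Δ L} → CedentOrFree Γ × CedentOrFree Δ → LinesOrFree L
        → LinesOrFree ((Γ ⇒ Δ) ∷ L)

-- Derivations of A ⪰ B may be exponentially large, since the same pair of formulas can be
-- simulated many times.  Every pair that occurs, however, consists of subformulas of A, B or
-- the extension axioms, so there are at most N² of them, N the size of the input.  Translating
-- each rule of ⪰ into a fixed derivation of at most 18 lines, and emitting the lines for each
-- pair only once, gives an eLNDT proof with O(N²) lines, each built from at most six formulas
-- of size at most N.  Every formula written down is a subformula of the input or an atom, so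
-- the proof is ∨-free, hence an eLDT proof, when the input is.
module Submission where

open import Defs
open import Data.Nat using (ℕ; suc; _+_; _*_; _^_; _≤_; _≤?_; z≤n; s≤s; s≤s⁻¹; >-nonZero)
open import Data.Nat.Properties
open import Data.Nat.Tactic.RingSolver using (solve-∀)
open import Data.List using (List; []; _∷_; _++_; [_]; length; map; concatMap; cartesianProduct)
open import Data.List.Properties using (length-++; length-map; length-removeAt′)
open import Data.List.Membership.Propositional using (_∈_)
open import Data.List.Membership.Propositional.Properties
  using (∈-++⁺ˡ; ∈-++⁺ʳ; ∈-concatMap⁺; ∈-cartesianProduct⁺)
open import Data.List.Relation.Unary.Any as Any using (Any; here; there; _─_)
open import Data.List.Relation.Unary.All as All using (All; []; _∷_)
open import Data.List.Relation.Unary.All.Properties using (¬Any⇒All¬)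
open import Data.List.Relation.Unary.AllPairs using ([]; _∷_)
open import Data.List.Relation.Unary.Unique.Propositional using (Unique)
open import Data.List.Relation.Binary.Subset.Propositional using (_⊆_)
open import Data.Product using (Σ; ∃; _×_; _,_)
open import Data.Product.Properties using (≡-dec)
open import Data.Empty using (⊥-elim)
open import Function using (_∘_; id)
open import Relation.Nullary using (yes; no)
open import Relation.Nullary.Decidable using (map′; _×-dec_; True; toWitness)
open import Relation.Binary.Definitions using (DecidableEquality)
open import Relation.Binary.PropositionalEquality
  using (_≡_; _≢_; refl; sym; trans; cong; cong₂; subst; module ≡-Reasoning)

infix 4 _≟ᶠ_ _≼_

_≟ᶠ_ : DecidableEquality Fm
𝟘 ≟ᶠ 𝟘 = yes refl
𝟙 ≟ᶠ 𝟙 = yes refl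
dt A p B ≟ᶠ dt C q D =
  map′ (λ { (refl , refl , refl) → refl }) (λ { refl → refl , refl , refl })
       (A ≟ᶠ C ×-dec p ≟ q ×-dec B ≟ᶠ D)
A ∨ B ≟ᶠ C ∨ D =
  map′ (λ { (refl , refl) → refl }) (λ { refl → refl , refl }) (A ≟ᶠ C ×-dec B ≟ᶠ D)
ext i ≟ᶠ ext j = map′ (cong ext) (λ { refl → refl }) (i ≟ j)
𝟘 ≟ᶠ 𝟙 = no λ ()
𝟘 ≟ᶠ dt _ _ _ = no λ ()
𝟘 ≟ᶠ _ ∨ _ = no λ ()
𝟘 ≟ᶠ ext _ = no λ ()
𝟙 ≟ᶠ 𝟘 = no λ ()
𝟙 ≟ᶠ dt _ _ _ = no λ ()
𝟙 ≟ᶠ _ ∨ _ = no λ ()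
𝟙 ≟ᶠ ext _ = no λ ()
dt _ _ _ ≟ᶠ 𝟘 = no λ ()
dt _ _ _ ≟ᶠ 𝟙 = no λ ()
dt _ _ _ ≟ᶠ _ ∨ _ = no λ ()
dt _ _ _ ≟ᶠ ext _ = no λ ()
_ ∨ _ ≟ᶠ 𝟘 = no λ ()
_ ∨ _ ≟ᶠ 𝟙 = no λ ()
_ ∨ _ ≟ᶠ dt _ _ _ = no λ ()
_ ∨ _ ≟ᶠ ext _ = no λ ()
ext _ ≟ᶠ 𝟘 = no λ ()
ext _ ≟ᶠ 𝟙 = no λ ()
ext _ ≟ᶠ dt _ _ _ = no λ ()
ext _ ≟ᶠ _ ∨ _ = no λ ()

open import Data.List.Membership.DecPropositional (≡-dec _≟ᶠ_ _≟ᶠ_) using (_∈?_)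

module _ {a} {A : Set a} where

  ∈-─⁺ : ∀ {x y} {ys : List A} (x∈ys : x ∈ ys) → y ∈ ys → x ≢ y → y ∈ (ys ─ x∈ys)
  ∈-─⁺ (here refl) (here refl) x≢y = ⊥-elim (x≢y refl)
  ∈-─⁺ (here _)    (there y∈)  _   = y∈
  ∈-─⁺ (there _)   (here refl) _   = here refl
  ∈-─⁺ (there x∈)  (there y∈)  x≢y = there (∈-─⁺ x∈ y∈ x≢y)

  unique-⊆⇒length≤ : ∀ {xs ys : List A} → Unique xs → xs ⊆ ys → length xs ≤ length ys
  unique-⊆⇒length≤ {[]}     _            _     = z≤n
  unique-⊆⇒length≤ {x ∷ xs} {ys} (x∉xs ∷ u) xs⊆ys = begin
    suc (length xs)           ≤⟨ s≤s (unique-⊆⇒length≤ u xs⊆ys─x) ⟩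
    suc (length (ys ─ x∈ys))  ≡⟨ sym (length-removeAt′ ys (Any.index x∈ys)) ⟩
    length ys                 ∎
    where
      open ≤-Reasoning
      x∈ys = xs⊆ys (here refl)
      xs⊆ys─x : xs ⊆ (ys ─ x∈ys)
      xs⊆ys─x y∈xs = ∈-─⁺ x∈ys (xs⊆ys (there y∈xs)) (All.lookup x∉xs y∈xs)

length-cartesianProduct : ∀ {a b} {A : Set a} {B : Set b} (xs : List A) (ys : List B) →
                          length (cartesianProduct xs ys) ≡ length xs * length ys
length-cartesianProduct []       ys = refl
length-cartesianProduct (x ∷ xs) ys = begin
  length (map (x ,_) ys ++ cartesianProduct xs ys)
    ≡⟨ length-++ (map (x ,_) ys) ⟩
  length (map (x ,_) ys) + length (cartesianProduct xs ys)
    ≡⟨ cong₂ _+_ (length-map (x ,_) ys) (length-cartesianProduct xs ys) ⟩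
  length ys + length xs * length ys ∎
  where open ≡-Reasoning

data _≼_ : Fm → Fm → Set where
  self : ∀ {X} → X ≼ X
  dtˡ  : ∀ {A p B Y} → dt A p B ≼ Y → A ≼ Y
  dtʳ  : ∀ {A p B Y} → dt A p B ≼ Y → B ≼ Y
  ∨ˡ   : ∀ {A B Y} → A ∨ B ≼ Y → A ≼ Y
  ∨ʳ   : ∀ {A B Y} → A ∨ B ≼ Y → B ≼ Y

subformulas properSubformulas : Fm → List Fm
subformulas X = X ∷ properSubformulas X
properSubformulas (dt A p B) = subformulas A ++ subformulas B
properSubformulas (A ∨ B)    = subformulas A ++ subformulas B
properSubformulas _          = []

length-subformulas : ∀ X → length (subformulas X) ≡ size X
length-subformulas 𝟘          = refl
length-subformulas 𝟙          = refl
length-subformulas (dt A p B) = cong suc (trans (length-++ (subformulas A))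
                                  (cong₂ _+_ (length-subformulas A) (length-subformulas B)))
length-subformulas (A ∨ B)    = cong suc (trans (length-++ (subformulas A))
                                  (cong₂ _+_ (length-subformulas A) (length-subformulas B)))
length-subformulas (ext i)    = refl

1≤size : ∀ X → 1 ≤ size X
1≤size X = subst (1 ≤_) (length-subformulas X) (s≤s z≤n)

≼⇒⊆ : ∀ {X Y} → X ≼ Y → subformulas X ⊆ subformulas Y
≼⇒⊆ self        x∈ = x∈
≼⇒⊆ (dtˡ q)     x∈ = ≼⇒⊆ q (there (∈-++⁺ˡ x∈))
≼⇒⊆ (dtʳ {A} q) x∈ = ≼⇒⊆ q (there (∈-++⁺ʳ (subformulas A) x∈))
≼⇒⊆ (∨ˡ q)      x∈ = ≼⇒⊆ q (there (∈-++⁺ˡ x∈))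
≼⇒⊆ (∨ʳ {A} q)  x∈ = ≼⇒⊆ q (there (∈-++⁺ʳ (subformulas A) x∈))

≼⇒∈subformulas : ∀ {X Y} → X ≼ Y → X ∈ subformulas Y
≼⇒∈subformulas q = ≼⇒⊆ q (here refl)

≼⇒size≤ : ∀ {X Y} → X ≼ Y → size X ≤ size Y
≼⇒size≤ self                = ≤-refl
≼⇒size≤ (dtˡ {A} {p} {B} q) = ≤-trans (m≤n⇒m≤1+n (m≤m+n (size A) (size B))) (≼⇒size≤ q)
≼⇒size≤ (dtʳ {A} {p} {B} q) = ≤-trans (m≤n⇒m≤1+n (m≤n+m (size B) (size A))) (≼⇒size≤ q)
≼⇒size≤ (∨ˡ {A} {B} q)      = ≤-trans (m≤n⇒m≤1+n (m≤m+n (size A) (size B))) (≼⇒size≤ q)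
≼⇒size≤ (∨ʳ {A} {B} q)      = ≤-trans (m≤n⇒m≤1+n (m≤n+m (size B) (size A))) (≼⇒size≤ q)

≼-orFree : ∀ {X Y} → OrFree Y → X ≼ Y → OrFree X
≼-orFree o self = o
≼-orFree o (dtˡ q) with ≼-orFree o q
... | ofdt oA _ = oA
≼-orFree o (dtʳ q) with ≼-orFree o q
... | ofdt _ oB = oB
≼-orFree o (∨ˡ q) with ≼-orFree o q
... | ()
≼-orFree o (∨ʳ q) with ≼-orFree o q
... | ()

At⇒∈ : ∀ {ℰ i E} → At ℰ i E → E ∈ ℰ
At⇒∈ here      = here refl
At⇒∈ (there a) = there (At⇒∈ a)

AllOrFree⇒All : ∀ ℰ → AllOrFree ℰ → All OrFree ℰ
AllOrFree⇒All []      _        = []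
AllOrFree⇒All (E ∷ ℰ) (o , os) = o ∷ AllOrFree⇒All ℰ os

any-≼⇒size< : ∀ {X} Φ → Any (X ≼_) Φ → suc (size X) ≤ sizeExt Φ
any-≼⇒size< (R ∷ Φ) (here q)  = s≤s (≤-trans (≼⇒size≤ q) (m≤m+n (size R) (sizeExt Φ)))
any-≼⇒size< (R ∷ Φ) (there q) = m≤n⇒m≤1+n (≤-trans (any-≼⇒size< Φ q) (m≤n+m (sizeExt Φ) (size R)))

length-concatMap-subformulas : ∀ Φ → length (concatMap subformulas Φ) ≤ sizeExt Φ
length-concatMap-subformulas []      = z≤n
length-concatMap-subformulas (R ∷ Φ) = m≤n⇒m≤1+n (begin
  length (subformulas R ++ concatMap subformulas Φ)
    ≡⟨ length-++ (subformulas R) ⟩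
  length (subformulas R) + length (concatMap subformulas Φ)
    ≤⟨ +-mono-≤ (≤-reflexive (length-subformulas R)) (length-concatMap-subformulas Φ) ⟩
  size R + sizeExt Φ ∎)
  where open ≤-Reasoning

Step⇒LDT : ∀ {ℰ L Γ Δ} → Step LNDT ℰ L (Γ ⇒ Δ) → CedentOrFree Γ × CedentOrFree Δ →
           Step LDT ℰ L (Γ ⇒ Δ)
Step⇒LDT (or-l _ _)      (() ∷ _ , _)
Step⇒LDT (or-r _)        (_ , () ∷ _)
Step⇒LDT (hyp-l a)       _ = hyp-l a
Step⇒LDT (hyp-r a)       _ = hyp-r a
Step⇒LDT ident           _ = ident
Step⇒LDT (cut m₁ m₂)     _ = cut m₁ m₂
Step⇒LDT (exch-l m)      _ = exch-l m
Step⇒LDT (exch-r m)      _ = exch-r m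
Step⇒LDT (weak-l m)      _ = weak-l m
Step⇒LDT (weak-r m)      _ = weak-r m
Step⇒LDT (contr-l m)     _ = contr-l m
Step⇒LDT (contr-r m)     _ = contr-r m
Step⇒LDT zero-l          _ = zero-l
Step⇒LDT (one-l m)       _ = one-l m
Step⇒LDT (zero-r m)      _ = zero-r m
Step⇒LDT one-r           _ = one-r
Step⇒LDT (dt-l m₁ m₂)    _ = dt-l m₁ m₂
Step⇒LDT (dt-r m₁ m₂)    _ = dt-r m₁ m₂

LinesOrFree⇒LDT : ∀ {ℰ L} → Lines LNDT ℰ L → LinesOrFree L → Lines LDT ℰ L
LinesOrFree⇒LDT []       []       = []
LinesOrFree⇒LDT (s ∷ ls) (o ∷ os) = Step⇒LDT s o ∷ LinesOrFree⇒LDT ls os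

-- Derivation trees with leaves among the lines L of a proof; extend writes their inner nodes
-- out as new lines, each of which must satisfy Ok.
module Derivations (ℰ : ExtAx) (Ok : Seq → Set) where

  record Valid (L : List Seq) : Set where
    constructor _,_
    field
      lines : Lines LNDT ℰ L
      ok    : All Ok L

  infix 3 _⊢_
  data _⊢_ (L : List Seq) : Seq → Set where
    line : ∀ {S} → S ∈ L → L ⊢ S
    by₀  : ∀ {S} → {{Ok S}} → (∀ {L′} → Step LNDT ℰ L′ S) → L ⊢ S
    by₁  : ∀ {S S₁} → {{Ok S}} → (∀ {L′} → S₁ ∈ L′ → Step LNDT ℰ L′ S) → L ⊢ S₁ → L ⊢ S
    by₂  : ∀ {S S₁ S₂} → {{Ok S}} → (∀ {L′} → S₁ ∈ L′ → S₂ ∈ L′ → Step LNDT ℰ L′ S)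
         → L ⊢ S₁ → L ⊢ S₂ → L ⊢ S

  steps : ∀ {L S} → L ⊢ S → ℕ
  steps (line _)      = 0
  steps (by₀ _)       = 1
  steps (by₁ _ t)     = suc (steps t)
  steps (by₂ _ t₁ t₂) = suc (steps t₁ + steps t₂)

  record Extension (L : List Seq) (k : ℕ) (S : Seq) : Set where
    field
      L′      : List Seq
      valid   : Valid L′
      ⊇L      : L ⊆ L′
      derives : S ∈ L′
      growth  : length L′ ≤ k + length L

  private
    push : ∀ {L S} → {{Ok S}} → Step LNDT ℰ L S → Valid L → Valid (S ∷ L)
    push {{ok}} s (ls , oks) = s ∷ ls , ok ∷ oks

  extend : ∀ {L₀ L S} → L₀ ⊆ L → (t : L₀ ⊢ S) → Valid L → Extension L (steps t) S
  extend L₀⊆L (line m) v = record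
    { L′ = _ ; valid = v ; ⊇L = id ; derives = L₀⊆L m ; growth = ≤-refl }
  extend L₀⊆L (by₀ r) v = record
    { L′ = _ ; valid = push r v ; ⊇L = there ; derives = here refl ; growth = ≤-refl }
  extend L₀⊆L (by₁ r t) v = record
    { L′ = _ ; valid = push (r derives) valid ; ⊇L = there ∘ ⊇L ; derives = here refl ; growth = s≤s growth }
    where open Extension (extend L₀⊆L t v)
  extend {L = L} L₀⊆L (by₂ r t₁ t₂) v = record
    { L′      = _
    ; valid   = push (r (E₂.⊇L E₁.derives) E₂.derives) E₂.valid
    ; ⊇L      = there ∘ E₂.⊇L ∘ E₁.⊇L
    ; derives = here refl
    ; growth  = s≤s (begin
        length E₂.L′                  ≤⟨ E₂.growth ⟩
        k₂ + length E₁.L′             ≤⟨ +-monoʳ-≤ k₂ E₁.growth ⟩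
        k₂ + (k₁ + length L)          ≡⟨ sym (+-assoc k₂ k₁ (length L)) ⟩
        k₂ + k₁ + length L            ≡⟨ cong (_+ length L) (+-comm k₂ k₁) ⟩
        k₁ + k₂ + length L            ∎)
    }
    where
      open ≤-Reasoning
      k₁ = steps t₁
      k₂ = steps t₂
      module E₁ = Extension (extend L₀⊆L t₁ v)
      module E₂ = Extension (extend (E₁.⊇L ∘ L₀⊆L) t₂ E₁.valid)

  restate : ∀ {L A Γ Δ} → {{Ok (A ∷ A ∷ Γ ⇒ Δ)}} → {{Ok (A ∷ Γ ⇒ Δ)}} →
            (A ∷ Γ ⇒ Δ) ∈ L → Valid L → Valid ((A ∷ Γ ⇒ Δ) ∷ (A ∷ A ∷ Γ ⇒ Δ) ∷ L)
  restate m v = push (contr-l (here refl)) (push (weak-l m) v)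

private
  cube : ∀ n → (2 * (n * n) + 18 * (n * n)) * (7 * n) ≡ 140 * (n * (n * (n * 1)))
  cube = solve-∀

poly-bound : ∀ {n ℓ} → 1 ≤ n → ℓ ≤ 2 + 18 * (n * n) → ℓ * (7 * n) ≤ 140 * n ^ 140
poly-bound {n} {ℓ} 1≤n ℓ≤ = begin
  ℓ * (7 * n)                             ≤⟨ *-monoˡ-≤ (7 * n) (≤-trans ℓ≤ (+-monoˡ-≤ (18 * (n * n)) 2≤2n²)) ⟩
  (2 * (n * n) + 18 * (n * n)) * (7 * n)  ≡⟨ cube n ⟩
  140 * n ^ 3                             ≤⟨ *-monoʳ-≤ 140 (^-monoʳ-≤ n {{>-nonZero 1≤n}} (m≤m+n 3 137)) ⟩
  140 * n ^ 140                           ∎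
  where
    open ≤-Reasoning
    2≤2n² : 2 ≤ 2 * (n * n)
    2≤2n² = *-monoʳ-≤ 2 (*-mono-≤ 1≤n 1≤n)

-- N is a parameter rather than a definition so that checking the final bound against the
-- statement never unfolds N ^ 140.
module Simulation (ℰ : ExtAx) (A₀ B₀ : Fm) (N : ℕ) (N-def : suc (size A₀ + size B₀ + sizeExt ℰ) ≡ N) where

  roots : List Fm
  roots = A₀ ∷ B₀ ∷ ℰ

  size-roots≡N : size A₀ + sizeExt (B₀ ∷ ℰ) ≡ N
  size-roots≡N = trans (+-suc (size A₀) (size B₀ + sizeExt ℰ))
             (trans (cong suc (sym (+-assoc (size A₀) (size B₀) (sizeExt ℰ)))) N-def)

  Sub : Fm → Set
  Sub X = Any (X ≼_) roots

  sub-axiom : ∀ {i E} → At ℰ i E → Sub E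
  sub-axiom a = there (there (Any.map (λ { refl → self }) (At⇒∈ a)))

  universe : List Fm
  universe = concatMap subformulas roots

  Sub⇒∈universe : ∀ {X} → Sub X → X ∈ universe
  Sub⇒∈universe s = ∈-concatMap⁺ subformulas (Any.map ≼⇒∈subformulas s)

  length-universe : length universe ≤ N
  length-universe = begin
    length (subformulas A₀ ++ concatMap subformulas (B₀ ∷ ℰ))
      ≡⟨ length-++ (subformulas A₀) ⟩
    length (subformulas A₀) + length (concatMap subformulas (B₀ ∷ ℰ))
      ≤⟨ +-mono-≤ (≤-reflexive (length-subformulas A₀)) (length-concatMap-subformulas (B₀ ∷ ℰ)) ⟩
    size A₀ + sizeExt (B₀ ∷ ℰ)
      ≡⟨ size-roots≡N ⟩
    N ∎
    where open ≤-Reasoning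

  Sub⇒size≤N : ∀ {X} → Sub X → size X ≤ N
  Sub⇒size≤N s = ≤-trans (s≤s⁻¹ (any-≼⇒size< roots s)) (≤-reflexive size-roots≡N)

  3≤N : 3 ≤ N
  3≤N = subst (3 ≤_) N-def
          (s≤s (≤-trans (+-mono-≤ (1≤size A₀) (1≤size B₀)) (m≤m+n (size A₀ + size B₀) (sizeExt ℰ))))

  1≤N : 1 ≤ N
  1≤N = ≤-trans (s≤s z≤n) 3≤N

  OrFreeRoots : Set
  OrFreeRoots = All OrFree roots

  Sub⇒orFree : ∀ {X} → OrFreeRoots → Sub X → OrFree X
  Sub⇒orFree os s = All.lookupWith ≼-orFree os s

  record Fine (X : Fm) : Set where
    field
      size≤N : size X ≤ N
      orFree : OrFreeRoots → OrFree X

  fine : ∀ {X} → Sub X → Fine X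
  fine s = record { size≤N = Sub⇒size≤N s ; orFree = λ os → Sub⇒orFree os s }

  instance
    fine-atom : ∀ {p} → Fine (atom p)
    fine-atom = record { size≤N = 3≤N ; orFree = λ _ → ofdt of𝟘 of𝟙 }

  data FineCedent : ℕ → List Fm → Set where
    instance
      nil  : ∀ {k} → FineCedent k []
      cons : ∀ {k X Γ} → {{Fine X}} → {{FineCedent k Γ}} → FineCedent (suc k) (X ∷ Γ)

  data FineSeq : Seq → Set where
    instance
      fineSeq : ∀ {Γ Δ} → {{FineCedent 3 Γ}} → {{FineCedent 3 Δ}} → FineSeq (Γ ⇒ Δ)

  FineCedent⇒size≤ : ∀ {k Γ} → FineCedent k Γ → sizeCedent Γ ≤ k * N
  FineCedent⇒size≤ nil                = z≤n
  FineCedent⇒size≤ (cons {{f}} {{c}}) = +-mono-≤ (Fine.size≤N f) (FineCedent⇒size≤ c)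

  FineSeq⇒size≤ : ∀ {S} → FineSeq S → sizeSeq S ≤ 7 * N
  FineSeq⇒size≤ (fineSeq {Γ} {Δ} {{c}} {{d}}) = begin
    suc (sizeCedent Γ + sizeCedent Δ)  ≤⟨ s≤s (+-mono-≤ (FineCedent⇒size≤ c) (FineCedent⇒size≤ d)) ⟩
    1 + (3 * N + 3 * N)                ≤⟨ +-monoˡ-≤ (3 * N + 3 * N) 1≤N ⟩
    N + (3 * N + 3 * N)                ≡⟨ 7* N ⟩
    7 * N                              ∎
    where
      open ≤-Reasoning
      7* : ∀ n → n + (3 * n + 3 * n) ≡ 7 * n
      7* = solve-∀

  FineCedent⇒orFree : ∀ {k Γ} → OrFreeRoots → FineCedent k Γ → CedentOrFree Γ
  FineCedent⇒orFree os nil                = []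
  FineCedent⇒orFree os (cons {{f}} {{c}}) = Fine.orFree f os ∷ FineCedent⇒orFree os c

  FineLines⇒orFree : ∀ {L} → OrFreeRoots → All FineSeq L → LinesOrFree L
  FineLines⇒orFree os []                         = []
  FineLines⇒orFree os (fineSeq {{c}} {{d}} ∷ fs) =
    (FineCedent⇒orFree os c , FineCedent⇒orFree os d) ∷ FineLines⇒orFree os fs

  FineLines⇒size≤ : ∀ {L} → All FineSeq L → sizeLines L ≤ length L * (7 * N)
  FineLines⇒size≤ []       = z≤n
  FineLines⇒size≤ (f ∷ fs) = +-mono-≤ (FineSeq⇒size≤ f) (FineLines⇒size≤ fs)

  open Derivations ℰ FineSeq

  -- One derivation per rule of ⪰; the simulation C ⪰ D is witnessed by the sequent D → C.
  derive-refl : ∀ {L C} → Sub C → L ⊢ [ C ] ⇒ [ C ]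
  derive-refl sC = by₀ ident
    where instance _ = fine sC

  derive-∨r : ∀ {L A C D} → Sub A → Sub (C ∨ D) →
              ([ C ] ⇒ [ A ]) ∈ L → ([ D ] ⇒ [ A ]) ∈ L → L ⊢ [ C ∨ D ] ⇒ [ A ]
  derive-∨r sA sCD m₁ m₂ = by₂ or-l (line m₁) (line m₂)
    where instance
      _ = fine sA
      _ = fine sCD

  derive-∨l₀ : ∀ {L C₀ C₁ D} → Sub (C₀ ∨ C₁) → Sub D →
               ([ D ] ⇒ [ C₀ ]) ∈ L → L ⊢ [ D ] ⇒ [ C₀ ∨ C₁ ]
  derive-∨l₀ sC sD m = by₁ or-r (by₁ (exch-r {Δ₁ = []}) (by₁ weak-r (line m)))
    where instance
      _ = fine sC
      _ = fine (Any.map ∨ˡ sC)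
      _ = fine (Any.map ∨ʳ sC)
      _ = fine sD

  derive-∨l₁ : ∀ {L C₀ C₁ D} → Sub (C₀ ∨ C₁) → Sub D →
               ([ D ] ⇒ [ C₁ ]) ∈ L → L ⊢ [ D ] ⇒ [ C₀ ∨ C₁ ]
  derive-∨l₁ sC sD m = by₁ or-r (by₁ weak-r (line m))
    where instance
      _ = fine sC
      _ = fine (Any.map ∨ˡ sC)
      _ = fine (Any.map ∨ʳ sC)
      _ = fine sD

  derive-extr : ∀ {L C i E} → At ℰ i E → Sub C → Sub (ext i) →
                ([ E ] ⇒ [ C ]) ∈ L → L ⊢ [ ext i ] ⇒ [ C ]
  derive-extr a sC sX m =
    by₂ cut (by₁ (exch-r {Δ₁ = []}) (by₁ weak-r (by₀ (hyp-l a))))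
            (by₁ (exch-l {Γ₁ = []}) (by₁ weak-l (line m)))
    where instance
      _ = fine sC
      _ = fine sX
      _ = fine (sub-axiom a)

  derive-extl : ∀ {L D i E} → At ℰ i E → Sub (ext i) → Sub D →
                ([ D ] ⇒ [ E ]) ∈ L → L ⊢ [ D ] ⇒ [ ext i ]
  derive-extl a sX sD m =
    by₂ cut (by₁ (exch-r {Δ₁ = []}) (by₁ weak-r (line m)))
            (by₁ (exch-l {Γ₁ = []}) (by₁ weak-l (by₀ (hyp-r a))))
    where instance
      _ = fine sX
      _ = fine sD
      _ = fine (sub-axiom a)

  derive-dt : ∀ {L A B C D p} → Sub (dt A p B) → Sub (dt C p D) →
              ([ C ] ⇒ [ A ]) ∈ L → ([ D ] ⇒ [ B ]) ∈ L → L ⊢ [ dt C p D ] ⇒ [ dt A p B ]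
  derive-dt {L} {A} {B} {C} {D} {p} sT sS m₁ m₂ = by₂ dt-l left right
    where
      instance
        _ = fine sT
        _ = fine sS
        _ = fine (Any.map dtˡ sT)
        _ = fine (Any.map dtʳ sT)
        _ = fine (Any.map dtˡ sS)
        _ = fine (Any.map dtʳ sS)
      P = atom p
      T = dt A p B
      p⊢p : L ⊢ [ P ] ⇒ [ P ]
      p⊢p = by₀ ident
      left : L ⊢ [ C ] ⇒ P ∷ T ∷ []
      left = by₁ (exch-r {Δ₁ = []}) (by₂ dt-r
        (by₁ (exch-r {Δ₁ = [ P ]}) (by₁ weak-r (by₁ weak-r (line m₁))))
        (by₁ weak-r (by₁ (exch-l {Γ₁ = []}) (by₁ weak-l p⊢p))))
      right : L ⊢ D ∷ P ∷ [] ⇒ [ T ]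
      right = by₂ dt-r
        (by₁ (exch-r {Δ₁ = []}) (by₁ weak-r (by₁ weak-l p⊢p)))
        (by₁ (exch-l {Γ₁ = [ P ]}) (by₁ weak-l (by₁ weak-l (line m₂))))

  record Memo (L : List Seq) : Set where
    field
      valid   : Valid L
      pairs   : List (Fm × Fm)
      unique  : Unique pairs
      bounded : pairs ⊆ cartesianProduct universe universe
      proven  : ∀ {C D} → (C , D) ∈ pairs → ([ D ] ⇒ [ C ]) ∈ L
      short   : length L ≤ 18 * length pairs

  empty : Memo []
  empty = record
    { valid = [] , [] ; pairs = [] ; unique = [] ; bounded = λ () ; proven = λ () ; short = z≤n }

  length-pairs : ∀ {L} (M : Memo L) → length (Memo.pairs M) ≤ N * N
  length-pairs M = begin
    length (Memo.pairs M)                        ≤⟨ unique-⊆⇒length≤ (Memo.unique M) (Memo.bounded M) ⟩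
    length (cartesianProduct universe universe)  ≡⟨ length-cartesianProduct universe universe ⟩
    length universe * length universe            ≤⟨ *-mono-≤ length-universe length-universe ⟩
    N * N                                        ∎
    where open ≤-Reasoning

  record Simulated (L : List Seq) (C D : Fm) : Set where
    field
      L′     : List Seq
      memo   : Memo L′
      ⊇L     : L ⊆ L′
      proves : ([ D ] ⇒ [ C ]) ∈ L′

  remember : ∀ {L C D} → Sub C → Sub D → Memo L →
             (t : L ⊢ [ D ] ⇒ [ C ]) → {True (steps t ≤? 18)} → Simulated L C D
  remember {L} {C} {D} sC sD M t {t≤18} with (C , D) ∈? Memo.pairs M
  ... | yes known = record { L′ = L ; memo = M ; ⊇L = id ; proves = Memo.proven M known }
  ... | no new    = record { L′ = L′ ; memo = M′ ; ⊇L = ⊇L ; proves = derives }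
    where
      open Extension (extend id t (Memo.valid M))
      bounded′ : (C , D) ∷ Memo.pairs M ⊆ cartesianProduct universe universe
      bounded′ (here refl) = ∈-cartesianProduct⁺ (Sub⇒∈universe sC) (Sub⇒∈universe sD)
      bounded′ (there q)   = Memo.bounded M q
      proven′ : ∀ {C′ D′} → (C′ , D′) ∈ (C , D) ∷ Memo.pairs M → ([ D′ ] ⇒ [ C′ ]) ∈ L′
      proven′ (here refl) = derives
      proven′ (there q)   = ⊇L (Memo.proven M q)
      M′ : Memo L′
      M′ = record
        { valid   = valid
        ; pairs   = (C , D) ∷ Memo.pairs M
        ; unique  = ¬Any⇒All¬ (Memo.pairs M) new ∷ Memo.unique M
        ; bounded = bounded′
        ; proven  = proven′
        ; short   = ≤-trans growth (≤-trans (+-mono-≤ (toWitness t≤18) (Memo.short M))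
                                             (≤-reflexive (sym (*-suc 18 (length (Memo.pairs M))))))
        }

  _>>=_ : ∀ {L C D C′ D′} → Simulated L C D →
          (∀ {L′} → Memo L′ → L ⊆ L′ → ([ D ] ⇒ [ C ]) ∈ L′ → Simulated L′ C′ D′) → Simulated L C′ D′
  r >>= k = record { L′ = R.L′ ; memo = R.memo ; ⊇L = R.⊇L ∘ ⊇L ; proves = R.proves }
    where
      open Simulated r
      module R = Simulated (k memo ⊇L proves)

  simulate : ∀ {L C D} → C ⪰⟨ ℰ ⟩ D → Sub C → Sub D → Memo L → Simulated L C D
  simulate sim-refl sC sD M = remember sC sD M (derive-refl sC)
  simulate (sim-∨r d₁ d₂) sC sD M =
    simulate d₁ sC (Any.map ∨ˡ sD) M  >>= λ M₁ _ m₁ →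
    simulate d₂ sC (Any.map ∨ʳ sD) M₁ >>= λ M₂ L₁⊆L₂ m₂ →
    remember sC sD M₂ (derive-∨r sC sD (L₁⊆L₂ m₁) m₂)
  simulate (sim-extr a d) sC sD M =
    simulate d sC (sub-axiom a) M >>= λ M₁ _ m →
    remember sC sD M₁ (derive-extr a sC sD m)
  simulate (sim-dt d₁ d₂) sC sD M =
    simulate d₁ (Any.map dtˡ sC) (Any.map dtˡ sD) M  >>= λ M₁ _ m₁ →
    simulate d₂ (Any.map dtʳ sC) (Any.map dtʳ sD) M₁ >>= λ M₂ L₁⊆L₂ m₂ →
    remember sC sD M₂ (derive-dt sC sD (L₁⊆L₂ m₁) m₂)
  simulate (sim-∨l₀ d) sC sD M =
    simulate d (Any.map ∨ˡ sC) sD M >>= λ M₁ _ m →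
    remember sC sD M₁ (derive-∨l₀ sC sD m)
  simulate (sim-∨l₁ d) sC sD M =
    simulate d (Any.map ∨ʳ sC) sD M >>= λ M₁ _ m →
    remember sC sD M₁ (derive-∨l₁ sC sD m)
  simulate (sim-extl a d) sC sD M =
    simulate d (sub-axiom a) sD M >>= λ M₁ _ m →
    remember sC sD M₁ (derive-extl a sC sD m)

  sub-A₀ : Sub A₀
  sub-A₀ = here self

  sub-B₀ : Sub B₀
  sub-B₀ = there (here self)

  simulation-proof : A₀ ⪰⟨ ℰ ⟩ B₀ →
    Σ (List Seq) λ L →
      IsProofOf LNDT ℰ ([ B₀ ] ⇒ [ A₀ ]) L
      × sizeLines (([ B₀ ] ⇒ [ A₀ ]) ∷ L) ≤ 140 * N ^ 140
      × (AllOrFree ℰ → OrFree A₀ → OrFree B₀ →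
           IsProofOf LDT ℰ ([ B₀ ] ⇒ [ A₀ ]) L × LinesOrFree (([ B₀ ] ⇒ [ A₀ ]) ∷ L))
  simulation-proof A⪰B =
    _ , lines , ≤-trans (FineLines⇒size≤ ok) (poly-bound {N} {2 + length L′} 1≤N (s≤s (s≤s lines≤))) ,
    λ oℰ oA oB → let os = FineLines⇒orFree (oA ∷ oB ∷ AllOrFree⇒All ℰ oℰ) ok
                 in  LinesOrFree⇒LDT lines os , os
    where
      instance
        _ = fine sub-A₀
        _ = fine sub-B₀
      open Simulated (simulate A⪰B sub-A₀ sub-B₀ empty)
      open Valid (restate proves (Memo.valid memo))
      lines≤ : length L′ ≤ 18 * (N * N)
      lines≤ = ≤-trans (Memo.short memo) (*-monoʳ-≤ 18 (length-pairs memo))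

proposition3p3 : ∃ λ (c : ℕ) →
    ∀ (ℰ : ExtAx) (A B : Fm) → WellFormed ℰ → A ⪰⟨ ℰ ⟩ B →
      Σ (List Seq) λ L →
        IsProofOf LNDT ℰ ((B ∷ []) ⇒ (A ∷ [])) L
        × sizeLines (((B ∷ []) ⇒ (A ∷ [])) ∷ L)
            ≤ c * suc (size A + size B + sizeExt ℰ) ^ c
        × (AllOrFree ℰ → OrFree A → OrFree B →
             IsProofOf LDT ℰ ((B ∷ []) ⇒ (A ∷ [])) L
             × LinesOrFree (((B ∷ []) ⇒ (A ∷ [])) ∷ L))
proposition3p3 = 140 , λ ℰ A B _ → Simulation.simulation-proof ℰ A B (suc (size A + size B + sizeExt ℰ)) refl
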